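{- Let $F$ be a graph with $x,y\in V(F)$ and let $\ell$ be a $2$-intersecting supermodular weakly subadditive integer-valued function on subsets of $V(F)$, such that $F$ is $\ell$-sparse. Let $A\subseteq V(F)$ be such that $F[A]$ is an $\ell$-rigid subgraph containing $x$ and $y$ with the minimum number of vertices. If $xy\notin E(F)$ and $B$ is a vertex set containing $x$ and $y$ such that $F[B]+xy$ is $\ell$-rigid, then $F[A\cup B]$ is $\ell$-rigid.
   Context: Graphs are finite, loopless, multiple edges allowed. $e_H(X)$ denotes the number of edges of $H$ with both ends in $X$; $F[X]$ is the induced subgraph. Set functions are zero on $\emptyset$, $\ell(v)=\ell(\{v\})$. $\ell$ is $2$-intersecting supermodular if $\ell(A\cap B)+\ell(A\cup B)\ge\ell(A)+\ell(B)$ whenever $|A\cap B|\ge 2$; weakly subadditive if $\sum_{v\in A}\ell(v)\ge\ell(A)$ for all $A$. A graph $H$ is $\ell$-sparse if $e_H(X)\le\sum_{v\in X}\ell(v)-\ell(X)$ for all $X\subseteq V(H)$, and $\ell$-rigid if it has a spanning $\ell$-sparse subgraph $F'$ with $|E(F')|=\sum_{v\in V(H)}\ell(v)-\ell(V(H))$. -}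

module Defs where

open import Data.Nat as ℕ using (ℕ)
open import Data.Integer as ℤ using (ℤ; _+_; _-_; _≤_; +_; 0ℤ)
open import Data.Fin using (Fin)
open import Data.Fin.Subset using (Subset; _∈_; _∉_; _⊆_; _∩_; _∪_; ⁅_⁆; ∣_∣; ⊥)
open import Data.Fin.Subset.Properties using (_∈?_)
open import Data.List using (List; []; _∷_; _++_; length; filter; foldr; map; allFin)
import Data.List.Relation.Binary.Sublist.Propositional as SL
open import Data.List.Membership.Propositional renaming (_∈_ to _∈ₗ_)
open import Data.Product using (_×_; _,_; proj₁; proj₂; ∃; Σ)
open import Relation.Nullary.Decidable using (_×-dec_)
open import Relation.Nullary using (¬_)
open import Data.Sum using (_⊎_)
open import Relation.Binary.PropositionalEquality using (_≡_; _≢_)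

-- An edge is a pair of vertices (read as unordered); a multigraph's edge
-- set is a list of edges (repetitions = parallel edges).
Edge : ℕ → Set
Edge n = Fin n × Fin n

SetFun : ℕ → Set
SetFun n = Subset n → ℤ

sumℤ : List ℤ → ℤ
sumℤ = foldr _+_ 0ℤ

elems : ∀ {n} → Subset n → List (Fin n)
elems X = filter (_∈? X) (allFin _)

Σℓ : ∀ {n} → SetFun n → Subset n → ℤ
Σℓ ℓ X = sumℤ (map (λ v → ℓ ⁅ v ⁆) (elems X))

eCount : ∀ {n} → List (Edge n) → Subset n → ℕ
eCount E X = length (filter (λ e → (proj₁ e ∈? X) ×-dec (proj₂ e ∈? X)) E)

ZeroOnEmpty : ∀ {n} → SetFun n → Set
ZeroOnEmpty ℓ = ℓ ⊥ ≡ 0ℤ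

TwoIntersectingSupermodular : ∀ {n} → SetFun n → Set
TwoIntersectingSupermodular ℓ =
  ∀ A B → 2 ℕ.≤ ∣ A ∩ B ∣ → ℓ A + ℓ B ≤ ℓ (A ∩ B) + ℓ (A ∪ B)

WeaklySubadditive : ∀ {n} → SetFun n → Set
WeaklySubadditive ℓ = ∀ A → ℓ A ≤ Σℓ ℓ A

Loopless : ∀ {n} → List (Edge n) → Set
Loopless E = ∀ e → e ∈ₗ E → proj₁ e ≢ proj₂ e

Sparse : ∀ {n} → SetFun n → Subset n → List (Edge n) → Set
Sparse ℓ V E = ∀ X → X ⊆ V → + eCount E X ≤ Σℓ ℓ X - ℓ X

Rigid : ∀ {n} → SetFun n → Subset n → List (Edge n) → Set
Rigid ℓ V E = Σ (List (Edge _)) λ E' →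
  (E' SL.⊆ E) × Sparse ℓ V E' × (+ length E' ≡ Σℓ ℓ V - ℓ V)

induced : ∀ {n} → List (Edge n) → Subset n → List (Edge n)
induced E X = filter (λ e → (proj₁ e ∈? X) ×-dec (proj₂ e ∈? X)) E

RigidInduced : ∀ {n} → SetFun n → List (Edge n) → Subset n → Set
RigidInduced ℓ E X = Rigid ℓ X (induced E X)

AdjacentIn : ∀ {n} → List (Edge n) → Fin n → Fin n → Set
AdjacentIn E x y = ((x , y) ∈ₗ E) ⊎ ((y , x) ∈ₗ E)

-- Write f(X) = Σ_{v∈X} ℓ(v) − ℓ(X) and i(X) = e_F(X).  As F is ℓ-sparse, F[X] is
-- ℓ-rigid exactly when f(X) ≤ i(X).  The edge count i is supermodular and f is
-- submodular on pairs meeting in at least two vertices, such as A and B.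
-- If F[A ∩ B] is rigid, minimality of A forces A ⊆ B; a spanning sparse subgraph of
-- F[B] + xy has at most f(A) ≤ i(A) edges inside A and no more edges outside A than
-- F[B], so F[B] = F[A ∪ B] is rigid.  Otherwise f(A ∩ B) ≥ i(A ∩ B) + 1, and
--   f(A ∩ B) + f(A ∪ B) ≤ f(A) + f(B) ≤ i(A) + i(B) + 1 ≤ i(A ∩ B) + i(A ∪ B) + 1
-- gives f(A ∪ B) ≤ i(A ∪ B).

module Submission where

open import Algebra.Bundles using (CommutativeMonoid)
open import Data.Fin using (Fin)
open import Data.Fin.Subset using (Subset; _∈_; _⊆_; _∩_; _∪_; ∣_∣; ⊤; ⁅_⁆)
open import Data.Fin.Subset.Properties
  using (_∈?_; x∈p∩q⁺; x∈p∩q⁻; x∈p∪q⁺; x∈p∪q⁻; p∩q⊆p; q⊆p∪q; ⊆-antisym; ∈⊤;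
         x∈⁅y⁆⇒x≡y; x≢y⇒x∉⁅y⁆; ∣⁅x⁆∣≡1; p⊂q⇒∣p∣<∣q∣)
open import Data.Integer as ℤ using (ℤ; +_; +≤+)
import Data.Integer.Properties as ℤ
import Data.Integer.Tactic.RingSolver as ℤ-Solver
open import Data.List using (List; []; _∷_; _++_; length; filter; foldr; map; allFin)
open import Data.List.Properties using (filter-++; filter-≐; filter-idem; filter-reject; length-++)
import Data.List.Relation.Binary.Sublist.Propositional as Sublist
import Data.List.Relation.Binary.Sublist.Heterogeneous.Properties as Sublist
open import Data.Nat as ℕ using (ℕ; suc; s≤s)
import Data.Nat.Properties as ℕ
open import Data.Product using (_×_; _,_; proj₁; proj₂)
open import Data.Sum using (inj₁; inj₂; [_,_])
open import Function using (id; _∘_)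
open import Level using (0ℓ)
open import Relation.Binary.PropositionalEquality
  using (_≡_; _≢_; refl; sym; trans; cong; cong₂; subst; module ≡-Reasoning)
open import Relation.Nullary using (¬_; Dec; yes; no; contradiction)
open import Relation.Nullary.Decidable using (_×-dec_)
open import Relation.Unary as U using (Pred; Decidable)
open import Relation.Unary.Properties using (_∩?_; _∪?_; ∁?)

open import Defs

module FilteredSum {c ℓ} (M : CommutativeMonoid c ℓ) where

  open CommutativeMonoid M
    using (Carrier; _∙_; ε; _≈_; setoid; assoc; ∙-congˡ; commutativeSemigroup)
    renaming (refl to ≈-refl)
  open import Algebra.Properties.CommutativeSemigroup commutativeSemigroup
    using (interchange; x∙yz≈y∙xz)
  open import Relation.Binary.Reasoning.Setoid setoid

  sumOver : ∀ {a p} {A : Set a} {P : Pred A p} → Decidable P → (A → Carrier) → List A → Carrier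
  sumOver P? w xs = foldr _∙_ ε (map w (filter P? xs))

  private
    shared : ∀ {u a b c d} → a ∙ b ≈ c ∙ d → (u ∙ a) ∙ (u ∙ b) ≈ (u ∙ c) ∙ (u ∙ d)
    shared {u} {a} {b} {c} {d} eq = begin
      (u ∙ a) ∙ (u ∙ b)  ≈⟨ interchange u a u b ⟩
      (u ∙ u) ∙ (a ∙ b)  ≈⟨ ∙-congˡ eq ⟩
      (u ∙ u) ∙ (c ∙ d)  ≈⟨ interchange u c u d ⟨
      (u ∙ c) ∙ (u ∙ d)  ∎

    onlyLeft : ∀ {u a b c d} → a ∙ b ≈ c ∙ d → (u ∙ a) ∙ b ≈ c ∙ (u ∙ d)
    onlyLeft {u} {a} {b} {c} {d} eq = begin
      (u ∙ a) ∙ b  ≈⟨ assoc u a b ⟩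
      u ∙ (a ∙ b)  ≈⟨ ∙-congˡ eq ⟩
      u ∙ (c ∙ d)  ≈⟨ x∙yz≈y∙xz u c d ⟩
      c ∙ (u ∙ d)  ∎

    onlyRight : ∀ {u a b c d} → a ∙ b ≈ c ∙ d → a ∙ (u ∙ b) ≈ c ∙ (u ∙ d)
    onlyRight {u} {a} {b} {c} {d} eq = begin
      a ∙ (u ∙ b)  ≈⟨ x∙yz≈y∙xz a u b ⟩
      u ∙ (a ∙ b)  ≈⟨ ∙-congˡ eq ⟩
      u ∙ (c ∙ d)  ≈⟨ x∙yz≈y∙xz c u d ⟨
      c ∙ (u ∙ d)  ∎

  sumOver-modular : ∀ {a p q} {A : Set a} {P : Pred A p} {Q : Pred A q}
    (P? : Decidable P) (Q? : Decidable Q) (w : A → Carrier) xs →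
    sumOver P? w xs ∙ sumOver Q? w xs ≈ sumOver (P? ∩? Q?) w xs ∙ sumOver (P? ∪? Q?) w xs
  sumOver-modular P? Q? w [] = ≈-refl
  sumOver-modular P? Q? w (x ∷ xs) with P? x | Q? x
  ... | yes _ | yes _ = shared (sumOver-modular P? Q? w xs)
  ... | yes _ | no _  = onlyLeft (sumOver-modular P? Q? w xs)
  ... | no _  | yes _ = onlyRight (sumOver-modular P? Q? w xs)
  ... | no _  | no _  = sumOver-modular P? Q? w xs

open FilteredSum using (sumOver; sumOver-modular)

length-∷ʳ : ∀ {a} {A : Set a} (xs : List A) {x : A} → length (xs ++ x ∷ []) ≡ suc (length xs)
length-∷ʳ xs = trans (length-++ xs) (ℕ.+-comm (length xs) 1)

count : ∀ {a p} {A : Set a} {P : Pred A p} → Decidable P → List A → ℕ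
count P? xs = length (filter P? xs)

module _ {a p} {A : Set a} {P : Pred A p} (P? : Decidable P) where

  count-++ : ∀ xs ys → count P? (xs ++ ys) ≡ count P? xs ℕ.+ count P? ys
  count-++ xs ys = trans (cong length (filter-++ P? xs ys)) (length-++ (filter P? xs))

  length≡count+count∁ : ∀ xs → length xs ≡ count P? xs ℕ.+ count (∁? P?) xs
  length≡count+count∁ [] = refl
  length≡count+count∁ (x ∷ xs) with P? x
  ... | yes _ = cong suc (length≡count+count∁ xs)
  ... | no _  = trans (cong suc (length≡count+count∁ xs)) (sym (ℕ.+-suc _ _))

  count≡sum-of-ones : ∀ xs → count P? xs ≡ sumOver ℕ.+-0-commutativeMonoid P? (λ _ → 1) xs
  count≡sum-of-ones xs = length≡Σ1 (filter P? xs)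
    where
    length≡Σ1 : (ys : List A) → length ys ≡ foldr ℕ._+_ 0 (map (λ _ → 1) ys)
    length≡Σ1 []       = refl
    length≡Σ1 (_ ∷ ys) = cong suc (length≡Σ1 ys)

module _ {a p q} {A : Set a} {P : Pred A p} {Q : Pred A q}
         (P? : Decidable P) (Q? : Decidable Q) where

  count-mono : P U.⊆ Q → ∀ {xs ys} → xs Sublist.⊆ ys → count P? xs ℕ.≤ count Q? ys
  count-mono P⊆Q xs⊆ys =
    Sublist.length-mono-≤ (Sublist.⊆-filter-Sublist P? Q? (λ { refl → P⊆Q }) xs⊆ys)

  count-modular : ∀ xs → count P? xs ℕ.+ count Q? xs ≡ count (P? ∩? Q?) xs ℕ.+ count (P? ∪? Q?) xs
  count-modular xs = begin
    count P? xs ℕ.+ count Q? xs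
      ≡⟨ cong₂ ℕ._+_ (count≡sum-of-ones P? xs) (count≡sum-of-ones Q? xs) ⟩
    ones P? ℕ.+ ones Q?
      ≡⟨ sumOver-modular ℕ.+-0-commutativeMonoid P? Q? (λ _ → 1) xs ⟩
    ones (P? ∩? Q?) ℕ.+ ones (P? ∪? Q?)
      ≡⟨ cong₂ ℕ._+_ (count≡sum-of-ones (P? ∩? Q?) xs) (count≡sum-of-ones (P? ∪? Q?) xs) ⟨
    count (P? ∩? Q?) xs ℕ.+ count (P? ∪? Q?) xs ∎
    where
    open ≡-Reasoning
    ones : ∀ {r} {R : Pred A r} → Decidable R → ℕ
    ones R? = sumOver ℕ.+-0-commutativeMonoid R? (λ _ → 1) xs

count≤count-filter : ∀ {a p q} {A : Set a} {P : Pred A p} {Q : Pred A q}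
  (P? : Decidable P) (Q? : Decidable Q) → P U.⊆ Q → ∀ xs → count P? xs ℕ.≤ count P? (filter Q? xs)
count≤count-filter P? Q? P⊆Q xs = begin
  count P? xs               ≡⟨ cong length (filter-idem P? xs) ⟨
  count P? (filter P? xs)   ≤⟨ count-mono P? P? id filterP⊆filterQ ⟩
  count P? (filter Q? xs)   ∎
  where
  open ℕ.≤-Reasoning
  filterP⊆filterQ : filter P? xs Sublist.⊆ filter Q? xs
  filterP⊆filterQ = Sublist.⊆-filter-Sublist P? Q? (λ { refl → P⊆Q }) (Sublist.⊆-refl {x = xs})

count-supermodular : ∀ {a p q r s} {A : Set a}
  {P : Pred A p} {Q : Pred A q} {R : Pred A r} {S : Pred A s}
  (P? : Decidable P) (Q? : Decidable Q) (R? : Decidable R) (S? : Decidable S) →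
  (P U.∩ Q) U.⊆ R → (P U.∪ Q) U.⊆ S → ∀ xs →
  count P? xs ℕ.+ count Q? xs ℕ.≤ count R? xs ℕ.+ count S? xs
count-supermodular P? Q? R? S? P∩Q⊆R P∪Q⊆S xs = begin
  count P? xs ℕ.+ count Q? xs                  ≡⟨ count-modular P? Q? xs ⟩
  count (P? ∩? Q?) xs ℕ.+ count (P? ∪? Q?) xs
    ≤⟨ ℕ.+-mono-≤ (count-mono (P? ∩? Q?) R? P∩Q⊆R xs⊆xs) (count-mono (P? ∪? Q?) S? P∪Q⊆S xs⊆xs) ⟩
  count R? xs ℕ.+ count S? xs                  ∎
  where
  open ℕ.≤-Reasoning
  xs⊆xs : xs Sublist.⊆ xs
  xs⊆xs = Sublist.⊆-refl

x∈p∧y∈p∧x≢y⇒2≤∣p∣ : ∀ {n} {x y : Fin n} {p : Subset n} → x ∈ p → y ∈ p → x ≢ y → 2 ℕ.≤ ∣ p ∣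
x∈p∧y∈p∧x≢y⇒2≤∣p∣ {x = x} {y} {p} x∈p y∈p x≢y =
  subst (ℕ._< ∣ p ∣) (∣⁅x⁆∣≡1 x) (p⊂q⇒∣p∣<∣q∣ (⁅x⁆⊆p , y , y∈p , x≢y⇒x∉⁅y⁆ (x≢y ∘ sym)))
  where
  ⁅x⁆⊆p : ⁅ x ⁆ ⊆ p
  ⁅x⁆⊆p z∈⁅x⁆ = subst (_∈ p) (sym (x∈⁅y⁆⇒x≡y x z∈⁅x⁆)) x∈p

∣p∣≤∣p∩q∣⇒p⊆q : ∀ {n} {p q : Subset n} → ∣ p ∣ ℕ.≤ ∣ p ∩ q ∣ → p ⊆ q
∣p∣≤∣p∩q∣⇒p⊆q {p = p} {q} ∣p∣≤∣p∩q∣ {x} x∈p with x ∈? q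
... | yes x∈q = x∈q
... | no  x∉q = contradiction ∣p∣≤∣p∩q∣
  (ℕ.<⇒≱ (p⊂q⇒∣p∣<∣q∣ (p∩q⊆p p q , x , x∈p , x∉q ∘ proj₂ ∘ x∈p∩q⁻ p q)))

p⊆q⇒p∪q≡q : ∀ {n} {p q : Subset n} → p ⊆ q → p ∪ q ≡ q
p⊆q⇒p∪q≡q {p = p} {q} p⊆q = ⊆-antisym ([ p⊆q , id ] ∘ x∈p∪q⁻ p q) (q⊆p∪q p q)

+-cancelˡ-≤ : ∀ k {m n} → k ℤ.+ m ℤ.≤ k ℤ.+ n → m ℤ.≤ n
+-cancelˡ-≤ k {m} {n} k+m≤k+n = begin
  m                      ≡⟨ cancel k m ⟨
  ℤ.- k ℤ.+ (k ℤ.+ m)    ≤⟨ ℤ.+-monoʳ-≤ (ℤ.- k) k+m≤k+n ⟩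
  ℤ.- k ℤ.+ (k ℤ.+ n)    ≡⟨ cancel k n ⟩
  n                      ∎
  where
  open ℤ.≤-Reasoning
  cancel : ∀ k m → ℤ.- k ℤ.+ (k ℤ.+ m) ≡ m
  cancel = ℤ-Solver.solve-∀

Within : ∀ {n} → Subset n → Pred (Edge n) 0ℓ
Within X e = proj₁ e ∈ X × proj₂ e ∈ X

within? : ∀ {n} (X : Subset n) → Decidable (Within X)
within? X e = (proj₁ e ∈? X) ×-dec (proj₂ e ∈? X)

eCount-supermodular : ∀ {n} (E : List (Edge n)) (A B : Subset n) →
  eCount E A ℕ.+ eCount E B ℕ.≤ eCount E (A ∩ B) ℕ.+ eCount E (A ∪ B)
eCount-supermodular E A B =
  count-supermodular (within? A) (within? B) (within? (A ∩ B)) (within? (A ∪ B))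
    (λ ((u∈A , v∈A) , (u∈B , v∈B)) → x∈p∩q⁺ (u∈A , u∈B) , x∈p∩q⁺ (v∈A , v∈B))
    [ (λ (u∈A , v∈A) → x∈p∪q⁺ (inj₁ u∈A) , x∈p∪q⁺ (inj₁ v∈A))
    , (λ (u∈B , v∈B) → x∈p∪q⁺ (inj₂ u∈B) , x∈p∪q⁺ (inj₂ v∈B)) ]
    E

eCount-induced : ∀ {n} (E : List (Edge n)) {A B : Subset n} →
  A ⊆ B → eCount E A ℕ.≤ eCount (induced E B) A
eCount-induced E A⊆B =
  count≤count-filter (within? _) (within? _) (λ (u∈A , v∈A) → A⊆B u∈A , A⊆B v∈A) E

Σℓ-modular : ∀ {n} (ℓ : SetFun n) (A B : Subset n) →
  Σℓ ℓ A ℤ.+ Σℓ ℓ B ≡ Σℓ ℓ (A ∩ B) ℤ.+ Σℓ ℓ (A ∪ B)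
Σℓ-modular ℓ A B = begin
  Σℓ ℓ A ℤ.+ Σℓ ℓ B
    ≡⟨ sumOver-modular ℤ.+-0-commutativeMonoid (_∈? A) (_∈? B) w vs ⟩
  sumℤ (map w (filter ((_∈? A) ∩? (_∈? B)) vs)) ℤ.+ sumℤ (map w (filter ((_∈? A) ∪? (_∈? B)) vs))
    ≡⟨ cong₂ ℤ._+_ (cong (sumℤ ∘ map w) (filter-≐ _ (_∈? A ∩ B) (x∈p∩q⁺ , x∈p∩q⁻ A B) vs))
                   (cong (sumℤ ∘ map w) (filter-≐ _ (_∈? A ∪ B) (x∈p∪q⁺ , x∈p∪q⁻ A B) vs)) ⟩
  Σℓ ℓ (A ∩ B) ℤ.+ Σℓ ℓ (A ∪ B) ∎
  where
  open ≡-Reasoning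
  w : Fin _ → ℤ
  w v = ℓ ⁅ v ⁆
  vs : List (Fin _)
  vs = allFin _

bound : ∀ {n} → SetFun n → Subset n → ℤ
bound ℓ X = Σℓ ℓ X ℤ.- ℓ X

bound-submodular : ∀ {n} {ℓ : SetFun n} → TwoIntersectingSupermodular ℓ →
  ∀ A B → 2 ℕ.≤ ∣ A ∩ B ∣ → bound ℓ (A ∩ B) ℤ.+ bound ℓ (A ∪ B) ℤ.≤ bound ℓ A ℤ.+ bound ℓ B
bound-submodular {ℓ = ℓ} supermodular A B 2≤∣A∩B∣ = begin
  bound ℓ (A ∩ B) ℤ.+ bound ℓ (A ∪ B)
    ≡⟨ regroup (Σℓ ℓ (A ∩ B)) (ℓ (A ∩ B)) (Σℓ ℓ (A ∪ B)) (ℓ (A ∪ B)) ⟩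
  (Σℓ ℓ (A ∩ B) ℤ.+ Σℓ ℓ (A ∪ B)) ℤ.- (ℓ (A ∩ B) ℤ.+ ℓ (A ∪ B))
    ≡⟨ cong (ℤ._- (ℓ (A ∩ B) ℤ.+ ℓ (A ∪ B))) (Σℓ-modular ℓ A B) ⟨
  (Σℓ ℓ A ℤ.+ Σℓ ℓ B) ℤ.- (ℓ (A ∩ B) ℤ.+ ℓ (A ∪ B))
    ≤⟨ ℤ.+-monoʳ-≤ (Σℓ ℓ A ℤ.+ Σℓ ℓ B) (ℤ.neg-mono-≤ (supermodular A B 2≤∣A∩B∣)) ⟩
  (Σℓ ℓ A ℤ.+ Σℓ ℓ B) ℤ.- (ℓ A ℤ.+ ℓ B)
    ≡⟨ regroup (Σℓ ℓ A) (ℓ A) (Σℓ ℓ B) (ℓ B) ⟨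
  bound ℓ A ℤ.+ bound ℓ B ∎
  where
  open ℤ.≤-Reasoning
  regroup : ∀ a b c d → (a ℤ.- b) ℤ.+ (c ℤ.- d) ≡ (a ℤ.+ c) ℤ.- (b ℤ.+ d)
  regroup = ℤ-Solver.solve-∀

induced-⊆ : ∀ {n} (E : List (Edge n)) X → induced E X Sublist.⊆ E
induced-⊆ E X = Sublist.filter-Sublist (within? X) (Sublist.⊆-refl {x = E})

Rigid⇒bound≤length : ∀ {n} {ℓ : SetFun n} {V L} → Rigid ℓ V L → bound ℓ V ℤ.≤ + length L
Rigid⇒bound≤length (E′ , E′⊆L , _ , |E′|≡bound) =
  ℤ.≤-trans (ℤ.≤-reflexive (sym |E′|≡bound)) (+≤+ (Sublist.length-mono-≤ E′⊆L))

Sparse⇒RigidInduced : ∀ {n} {ℓ : SetFun n} (E : List (Edge n)) → Sparse ℓ ⊤ E →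
  ∀ X → bound ℓ X ℤ.≤ + eCount E X → RigidInduced ℓ E X
Sparse⇒RigidInduced {ℓ = ℓ} E sparse X bound≤eCount =
  induced E X , Sublist.⊆-refl , induced-sparse , ℤ.≤-antisym (sparse X (λ _ → ∈⊤)) bound≤eCount
  where
  induced-sparse : Sparse ℓ X (induced E X)
  induced-sparse Y _ = ℤ.≤-trans
    (+≤+ (count-mono (within? Y) (within? Y) id (induced-⊆ E X)))
    (sparse Y (λ _ → ∈⊤))

bound≤eCount-without-inner-edge : ∀ {n} {ℓ : SetFun n} (E : List (Edge n)) {A B e} →
  A ⊆ B → Within A e → bound ℓ A ℤ.≤ + eCount E A →
  Rigid ℓ B (induced E B ++ e ∷ []) → bound ℓ B ℤ.≤ + eCount E B
bound≤eCount-without-inner-edge E {A} {B} {e} A⊆B e∈A A-tight (E′ , E′⊆ , E′-sparse , |E′|≡bound) =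
  ℤ.≤-trans (ℤ.≤-reflexive (sym |E′|≡bound)) (+≤+ |E′|≤eCount)
  where
  open ℕ.≤-Reasoning
  L : List (Edge _)
  L = induced E B
  inA : Decidable (Within A)
  inA = within? A
  outA : Decidable (U.∁ (Within A))
  outA = ∁? inA

  inner : count inA E′ ℕ.≤ count inA L
  inner = ℕ.≤-trans (ℤ.drop‿+≤+ (ℤ.≤-trans (E′-sparse A A⊆B) A-tight)) (eCount-induced E A⊆B)

  e-not-outside : count outA (e ∷ []) ≡ 0
  e-not-outside = cong length (filter-reject outA (λ e∉A → e∉A e∈A))

  outer : count outA E′ ℕ.≤ count outA L
  outer = begin
    count outA E′                              ≤⟨ count-mono outA outA id E′⊆ ⟩
    count outA (L ++ e ∷ [])                   ≡⟨ count-++ outA L (e ∷ []) ⟩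
    count outA L ℕ.+ count outA (e ∷ [])       ≡⟨ cong (count outA L ℕ.+_) e-not-outside ⟩
    count outA L ℕ.+ 0                         ≡⟨ ℕ.+-identityʳ _ ⟩
    count outA L                               ∎

  |E′|≤eCount : length E′ ℕ.≤ length L
  |E′|≤eCount = begin
    length E′                             ≡⟨ length≡count+count∁ inA E′ ⟩
    count inA E′ ℕ.+ count outA E′        ≤⟨ ℕ.+-mono-≤ inner outer ⟩
    count inA L ℕ.+ count outA L          ≡⟨ length≡count+count∁ inA L ⟨
    length L                              ∎

bound≤eCount-union : ∀ {n} {ℓ : SetFun n} → TwoIntersectingSupermodular ℓ → (E : List (Edge n)) →
  ∀ {A B} → 2 ℕ.≤ ∣ A ∩ B ∣ →
  bound ℓ A ℤ.≤ + eCount E A → bound ℓ B ℤ.≤ + suc (eCount E B) →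
  + eCount E (A ∩ B) ℤ.< bound ℓ (A ∩ B) → bound ℓ (A ∪ B) ℤ.≤ + eCount E (A ∪ B)
bound≤eCount-union {ℓ = ℓ} supermodular E {A} {B} 2≤∣A∩B∣ A-tight B-almost-tight A∩B-loose =
  +-cancelˡ-≤ (bound ℓ (A ∩ B)) (begin
    bound ℓ (A ∩ B) ℤ.+ bound ℓ (A ∪ B)  ≤⟨ bound-submodular supermodular A B 2≤∣A∩B∣ ⟩
    bound ℓ A ℤ.+ bound ℓ B              ≤⟨ ℤ.+-mono-≤ A-tight B-almost-tight ⟩
    + a ℤ.+ + suc b                      ≡⟨ ℤ.pos-+ a (suc b) ⟨
    + (a ℕ.+ suc b)                      ≤⟨ +≤+ a+1+b≤1+i+u ⟩
    + (suc i ℕ.+ u)                      ≡⟨ ℤ.pos-+ (suc i) u ⟩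
    + suc i ℤ.+ + u                      ≤⟨ ℤ.+-monoˡ-≤ (+ u) (ℤ.i<j⇒suc[i]≤j A∩B-loose) ⟩
    bound ℓ (A ∩ B) ℤ.+ + u              ∎)
  where
  open ℤ.≤-Reasoning
  a b i u : ℕ
  a = eCount E A
  b = eCount E B
  i = eCount E (A ∩ B)
  u = eCount E (A ∪ B)

  a+1+b≤1+i+u : a ℕ.+ suc b ℕ.≤ suc i ℕ.+ u
  a+1+b≤1+i+u = ℕ.≤-trans (ℕ.≤-reflexive (ℕ.+-suc a b)) (s≤s (eCount-supermodular E A B))


proposition2p3 : ∀ {n} (E : List (Edge n)) (x y : Fin n) (ℓ : SetFun n)
    → Loopless E
    → ZeroOnEmpty ℓ
    → TwoIntersectingSupermodular ℓ
    → WeaklySubadditive ℓ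
    → Sparse ℓ ⊤ E
    → (A : Subset n)
    → x ∈ A → y ∈ A → RigidInduced ℓ E A
    → (∀ A′ → x ∈ A′ → y ∈ A′ → RigidInduced ℓ E A′ → ∣ A ∣ ℕ.≤ ∣ A′ ∣)
    → x ≢ y
    → ¬ AdjacentIn E x y
    → (B : Subset n) → x ∈ B → y ∈ B
    → Rigid ℓ B (induced E B ++ ((x , y) ∷ []))
    → RigidInduced ℓ E (A ∪ B)
proposition2p3 E x y ℓ _ _ supermodular _ sparse
               A x∈A y∈A A-rigid A-minimal x≢y _ B x∈B y∈B B+xy-rigid =
  by-cases (bound ℓ (A ∩ B) ℤ.≤? + eCount E (A ∩ B))
  where
  x∈A∩B : x ∈ A ∩ B
  x∈A∩B = x∈p∩q⁺ (x∈A , x∈B)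
  y∈A∩B : y ∈ A ∩ B
  y∈A∩B = x∈p∩q⁺ (y∈A , y∈B)
  A-tight : bound ℓ A ℤ.≤ + eCount E A
  A-tight = Rigid⇒bound≤length A-rigid
  B-almost-tight : bound ℓ B ℤ.≤ + suc (eCount E B)
  B-almost-tight = ℤ.≤-trans (Rigid⇒bound≤length B+xy-rigid)
                             (ℤ.≤-reflexive (cong +_ (length-∷ʳ (induced E B))))

  by-cases : Dec (bound ℓ (A ∩ B) ℤ.≤ + eCount E (A ∩ B)) → RigidInduced ℓ E (A ∪ B)
  by-cases (yes A∩B-tight) =
    subst (RigidInduced ℓ E) (sym (p⊆q⇒p∪q≡q A⊆B))
      (Sparse⇒RigidInduced E sparse B
        (bound≤eCount-without-inner-edge E A⊆B (x∈A , y∈A) A-tight B+xy-rigid))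
    where
    A⊆B : A ⊆ B
    A⊆B = ∣p∣≤∣p∩q∣⇒p⊆q
      (A-minimal (A ∩ B) x∈A∩B y∈A∩B (Sparse⇒RigidInduced E sparse (A ∩ B) A∩B-tight))
  by-cases (no A∩B-not-tight) =
    Sparse⇒RigidInduced E sparse (A ∪ B)
      (bound≤eCount-union supermodular E (x∈p∧y∈p∧x≢y⇒2≤∣p∣ x∈A∩B y∈A∩B x≢y)
        A-tight B-almost-tight (ℤ.≰⇒> A∩B-not-tight))
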